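{- Let $k$ be a non-negative integer and let $P$ be a finite propositional logic program. Then $P$ has a stable model of size at most $k$ if and only if the propositional theory $T(P)$ has a model consisting of at most $(k+1)(k^2+2k)$ atoms.
   Context: A logic program is a finite set of rules $r$ of the form $q \leftarrow a_1,\ldots,a_s,\mathbf{not}(b_1),\ldots,\mathbf{not}(b_t)$ with $q,a_i,b_j$ propositional atoms; $\mathrm{At}(P)$ is the set of atoms of $P$. For $M\subseteq\mathrm{At}(P)$ the reduct $P^M$ deletes every rule having some $b_j\in M$ and deletes negated atoms from the remaining rules; $M$ is a stable model if $M$ equals the least model of $P^M$. Given $k$: for each $q\in\mathrm{At}(P)$ introduce new propositional atoms $c(q)$, $c(q,i)$ ($1\le i\le k+1$), $c^-(q,i)$ ($2\le i\le k+1$), $d(q,i)$ ($1\le i\le k^2+2k$). Let $F_1(q,i)$ ($2\le i\le k+1$) be $c^-(q,i)\Leftrightarrow c(q,1)\vee\cdots\vee c(q,i-1)$, and $F_2(q)$ be $c(q)\Leftrightarrow c(q,1)\vee\cdots\vee c(q,k+1)$. For a rule $r=q\leftarrow a_1,\ldots,a_s,\mathbf{not}(b_1),\ldots,\mathbf{not}(b_t)$ and $2\le i\le k+1$, $F_3(r,i)=c^-(a_1,i)\wedge\cdots\wedge c^-(a_s,i)\wedge\neg c(b_1)\wedge\cdots\wedge\neg c(b_t)\wedge\neg c^-(q,i)$; $F_3(r,1)$ is $\mathbf{false}$ if $s\ge1$ and is $\neg c(b_1)\wedge\cdots\wedge\neg c(b_t)$ if $s=0$. For $q$ with $r_1,\ldots,r_v$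 all rules of $P$ with head $q$ and $1\le i\le k+1$, $F_4(q,i)$ is $c(q,i)\Leftrightarrow F_3(r_1,i)\vee\cdots\vee F_3(r_v,i)$ (empty disjunction is false). $T_0(P)=\{F_1(q,i)\colon q\in\mathrm{At}(P),2\le i\le k+1\}\cup\{F_2(q)\colon q\in\mathrm{At}(P)\}\cup\{F_4(q,i)\colon q\in\mathrm{At}(P),1\le i\le k+1\}$, and $T(P)=T_0(P)\cup\{c(q)\Leftrightarrow d(q,i)\colon q\in\mathrm{At}(P),\ 1\le i\le k^2+2k\}$. A model of $T(P)$ is a set of atoms of $T(P)$ whose characteristic valuation satisfies every formula. -}

module Defs where

open import Data.Nat using (ℕ; zero; suc; _+_; _*_; _≤_; _≟_)
open import Data.List using (List; []; _∷_; _++_; map; concatMap; upTo; filter; length)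
open import Data.List.Relation.Unary.All using (All)
open import Data.List.Relation.Unary.Any using (any?)
open import Data.List.Relation.Unary.Unique.Propositional using (Unique)
open import Data.List.Membership.Propositional using (_∈_)
open import Data.List.Membership.DecPropositional _≟_ using (_∈?_)
open import Data.Product using (_×_; ∃)
open import Data.Empty using (⊥)
open import Data.Unit using (⊤)
open import Relation.Nullary using (¬_; yes; no)
open import Relation.Binary.PropositionalEquality using (_≡_)

-- q ← a₁,…,a_s, not(b₁),…,not(b_t)
record Rule : Set where
  constructor rule
  field
    head : ℕ
    pos  : List ℕ
    neg  : List ℕ
open Rule public

Program : Set
Program = List Rule

At : Program → List ℕ
At = concatMap (λ r → head r ∷ (pos r ++ neg r))

record DRule : Set where
  constructor drule
  field
    dhead : ℕ
    dbody : List ℕ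
open DRule public

reduct : List ℕ → Program → List DRule
reduct M [] = []
reduct M (r ∷ P) with any? (_∈? M) (neg r)
... | yes _ = reduct M P
... | no  _ = drule (head r) (pos r) ∷ reduct M P

data LeastModel (D : List DRule) : ℕ → Set where
  derive : ∀ {q body} → drule q body ∈ D → All (LeastModel D) body →
           LeastModel D q

StableModel : Program → List ℕ → Set
StableModel P M =
  Unique M × All (_∈ At P) M ×
  (∀ q → (q ∈ M → LeastModel (reduct M P) q) × (LeastModel (reduct M P) q → q ∈ M))

data TAtom : Set where
  c  : ℕ → TAtom
  ci : ℕ → ℕ → TAtom
  c⁻ : ℕ → ℕ → TAtom
  d  : ℕ → ℕ → TAtom

data Form : Set where
  var  : TAtom → Form
  ⊥f   : Form
  ¬f   : Form → Form
  ⋀    : List Form → Form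
  ⋁    : List Form → Form
  _⇔f_ : Form → Form → Form

mutual
  ⟦_⟧_ : Form → (TAtom → Set) → Set
  ⟦ var x ⟧ v = v x
  ⟦ ⊥f ⟧ v = ⊥
  ⟦ ¬f F ⟧ v = ¬ (⟦ F ⟧ v)
  ⟦ ⋀ Fs ⟧ v = ⟦⋀⟧ Fs v
  ⟦ ⋁ Fs ⟧ v = ⟦⋁⟧ Fs v
  ⟦ F ⇔f G ⟧ v = (⟦ F ⟧ v → ⟦ G ⟧ v) × (⟦ G ⟧ v → ⟦ F ⟧ v)

  ⟦⋀⟧ : List Form → (TAtom → Set) → Set
  ⟦⋀⟧ [] v = ⊤
  ⟦⋀⟧ (F ∷ Fs) v = ⟦ F ⟧ v × ⟦⋀⟧ Fs v

  ⟦⋁⟧ : List Form → (TAtom → Set) → Set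
  ⟦⋁⟧ [] v = ⊥
  ⟦⋁⟧ (F ∷ Fs) v = Data.Sum._⊎_ (⟦ F ⟧ v) (⟦⋁⟧ Fs v)
    where import Data.Sum

mutual
  atomsF : Form → List TAtom
  atomsF (var x) = x ∷ []
  atomsF ⊥f = []
  atomsF (¬f F) = atomsF F
  atomsF (⋀ Fs) = atomsL Fs
  atomsF (⋁ Fs) = atomsL Fs
  atomsF (F ⇔f G) = atomsF F ++ atomsF G

  atomsL : List Form → List TAtom
  atomsL [] = []
  atomsL (F ∷ Fs) = atomsF F ++ atomsL Fs

range1 : ℕ → List ℕ
range1 n = map suc (upTo n)

range2 : ℕ → List ℕ
range2 k = map (λ j → 2 + j) (upTo k)

F₁ : ℕ → ℕ → Form
F₁ q i = var (c⁻ q i) ⇔f ⋁ (map (λ j → var (ci q j)) (range1 (Data.Nat._∸_ i 1)))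
  where import Data.Nat

F₂ : ℕ → ℕ → Form
F₂ k q = var (c q) ⇔f ⋁ (map (λ j → var (ci q j)) (range1 (suc k)))

F₃ : Rule → ℕ → Form
F₃ r (suc zero) with pos r
... | []    = ⋀ (map (λ b → ¬f (var (c b))) (neg r))
... | _ ∷ _ = ⊥f
F₃ r i = ⋀ (map (λ a → var (c⁻ a i)) (pos r) ++
            map (λ b → ¬f (var (c b))) (neg r) ++
            (¬f (var (c⁻ (head r) i)) ∷ []))

rulesWithHead : Program → ℕ → List Rule
rulesWithHead P q = filter (λ r → head r ≟ q) P

F₄ : Program → ℕ → ℕ → Form
F₄ P q i = var (ci q i) ⇔f ⋁ (map (λ r → F₃ r i) (rulesWithHead P q))

T₀ : ℕ → Program → List Form
T₀ k P =
  concatMap (λ q → map (F₁ q) (range2 k)) (At P) ++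
  map (F₂ k) (At P) ++
  concatMap (λ q → map (F₄ P q) (range1 (suc k))) (At P)

T : ℕ → Program → List Form
T k P = T₀ k P ++
  concatMap (λ q → map (λ i → var (c q) ⇔f var (d q i)) (range1 (k * k + 2 * k))) (At P)

AtT : ℕ → Program → List TAtom
AtT k P = atomsL (T k P)

ModelT : ℕ → Program → List TAtom → Set
ModelT k P N =
  Unique N × All (_∈ AtT k P) N × All (λ F → ⟦ F ⟧ (λ x → x ∈ N)) (T k P)

-- Read T(P) through the stages S₀ ⊆ S₁ ⊆ … of the immediate-consequence operator of the
-- reduct P^M: the intended meaning is c(q) ⟺ q ∈ M, c(q,i) ⟺ q enters at stage i, and
-- c⁻(q,i) ⟺ q ∈ S_{i-1}; the d(q,·) are K = k² + 2k copies of c(q).  Under the reading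
-- c(q) ⟺ q ∈ M, the formulas F₁ and F₄ force the meaning of c⁻(q,i) and c(q,i) by induction
-- on i, and F₂ forces q ∈ M ⟺ q ∈ S_{k+1}.
--   A stable model M with |M| ≤ k is reached after at most k stages (the stages grow
-- strictly until they stop), so the intended valuation is a model with at most
-- k (K + k + 2) = (k + 1) K atoms.  Conversely, in a model with at most (k + 1) K atoms each
-- true c(q) drags its K copies along, so |M| ≤ k for M = {q ∣ c(q)}; then S_{k+1} = M is
-- also a fixpoint, i.e. the least model of P^M.

module Submission where

open import Defs
open import Data.Nat using (ℕ; zero; suc; _+_; _*_; _≤_; _<_; z≤n; s≤s; z<s; _≟_; _⊔_; _<?_)
open import Data.Nat.Properties
open import Data.Nat.Induction using (<-rec)
open import Data.Nat.Tactic.RingSolver using (solve-∀)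
open import Data.List using (List; []; _∷_; _++_; map; concatMap; upTo; filter; length)
open import Data.List.Properties using (length-++; length-map; length-filter; length-upTo; length-removeAt′)
open import Data.List.Relation.Unary.All as All using (All; []; _∷_)
open import Data.List.Relation.Unary.All.Properties using (¬Any⇒All¬; All¬⇒¬Any)
open import Data.List.Relation.Unary.Any as Any using (Any; here; there; any?; _─_)
open import Data.List.Relation.Unary.Unique.Propositional using (Unique)
import Data.List.Relation.Unary.Unique.Propositional.Properties as Unique
open import Data.List.Relation.Unary.AllPairs using ([]; _∷_)
open import Data.List.Relation.Binary.Disjoint.Propositional using (Disjoint)
open import Data.List.Membership.Propositional using (_∈_; _∉_; find; lose)
open import Data.List.Membership.Propositional.Properties
open import Data.List.Membership.DecPropositional _≟_ using (_∈?_)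
open import Data.Product as Product using (∃; _×_; _,_; proj₁; proj₂)
open import Data.Sum using (_⊎_; inj₁; inj₂)
open import Data.Empty using (⊥; ⊥-elim)
open import Data.Unit using (tt)
open import Relation.Nullary using (¬_; Dec; yes; no; contradiction)
open import Relation.Nullary.Decidable using (_×-dec_; ¬?)
open import Relation.Binary.PropositionalEquality using (_≡_; _≢_; refl; sym; trans; cong; cong₂; subst)
open import Function.Bundles using (_⇔_; mk⇔; Equivalence)
import Function.Properties.Equivalence as ⇔
open import Function.Base using (_∘_)

open Equivalence using (to; from)

module _ {A : Set} where

  ∈-removeAt : ∀ {x z : A} {ys} (x∈ys : x ∈ ys) → z ∈ ys → z ≢ x → z ∈ (ys ─ x∈ys)
  ∈-removeAt (here refl) (here refl) z≢x = contradiction refl z≢x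
  ∈-removeAt (here refl) (there z∈ys) _  = z∈ys
  ∈-removeAt (there _)   (here refl)  _  = here refl
  ∈-removeAt (there x∈ys) (there z∈ys) z≢x = there (∈-removeAt x∈ys z∈ys z≢x)

  unique-⊆⇒length-≤ : ∀ {xs ys : List A} → Unique xs → (∀ {z} → z ∈ xs → z ∈ ys) →
                      length xs ≤ length ys
  unique-⊆⇒length-≤ {[]}     _          _  = z≤n
  unique-⊆⇒length-≤ {x ∷ xs} {ys} (x∉xs ∷ u) xs⊆ys =
    subst (suc (length xs) ≤_) (sym (length-removeAt′ ys (Any.index x∈ys)))
      (s≤s (unique-⊆⇒length-≤ u λ z∈xs →
        ∈-removeAt x∈ys (xs⊆ys (there z∈xs)) λ z≡x → All.lookup x∉xs z∈xs (sym z≡x)))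
    where x∈ys = xs⊆ys (here refl)

  ∉-map : ∀ {B : Set} {f : B → A} {x} (ys : List B) → (∀ y → f y ≢ x) → x ∉ map f ys
  ∉-map ys f≢x x∈ with ∈-map⁻ _ x∈
  ... | y , _ , refl = f≢x y refl

  disjoint-map : ∀ {B C : Set} {f : B → A} {g : C → A} (ys : List B) (zs : List C) →
                 (∀ y z → f y ≢ g z) → Disjoint (map f ys) (map g zs)
  disjoint-map ys zs f≢g (x∈fys , x∈gzs) with ∈-map⁻ _ x∈fys
  ... | y , _ , refl = ∉-map zs (λ z gz≡fy → f≢g y z (sym gz≡fy)) x∈gzs

module _ {A B : Set} (f : A → List B) where

  length-concatMap-const : ∀ n xs → (∀ x → length (f x) ≡ n) → length (concatMap f xs) ≡ length xs * n
  length-concatMap-const n []       _   = refl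
  length-concatMap-const n (x ∷ xs) |f| =
    trans (length-++ (f x)) (cong₂ _+_ (|f| x) (length-concatMap-const n xs |f|))

  length-concatMap-≤ : ∀ n xs → (∀ x → length (f x) ≤ n) → length (concatMap f xs) ≤ length xs * n
  length-concatMap-≤ n []       _   = z≤n
  length-concatMap-≤ n (x ∷ xs) |f| =
    subst (_≤ _) (sym (length-++ (f x))) (+-mono-≤ (|f| x) (length-concatMap-≤ n xs |f|))

  unique-concatMap : (owner : B → A) → (∀ {x y} → y ∈ f x → owner y ≡ x) →
                     ∀ {xs} → Unique xs → (∀ x → Unique (f x)) → Unique (concatMap f xs)
  unique-concatMap owner owned {[]}     _          _  = []
  unique-concatMap owner owned {x ∷ xs} (x∉xs ∷ u) uf =
    Unique.++⁺ (uf x) (unique-concatMap owner owned u uf) disjoint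
    where
      disjoint : Disjoint (f x) (concatMap f xs)
      disjoint (y∈fx , y∈rest) with find (∈-concatMap⁻ f y∈rest)
      ... | x′ , x′∈xs , y∈fx′ = All.lookup x∉xs x′∈xs (trans (sym (owned y∈fx)) (owned y∈fx′))

module Chain {A : Set} (Q : ℕ → A → Set) (Q? : ∀ j x → Dec (Q j x))
             (Q-step : ∀ {j x} → Q j x → Q (suc j) x) where

  Stuck : List A → ℕ → Set
  Stuck xs j = ∀ {x} → x ∈ xs → Q (suc j) x → Q j x

  count : ℕ → List A → ℕ
  count j []       = 0
  count j (x ∷ xs) with Q? j x
  ... | yes _ = suc (count j xs)
  ... | no  _ = count j xs

  count≤length : ∀ j xs → count j xs ≤ length xs
  count≤length j []       = z≤n
  count≤length j (x ∷ xs) with Q? j x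
  ... | yes _ = s≤s (count≤length j xs)
  ... | no  _ = m≤n⇒m≤1+n (count≤length j xs)

  count-step : ∀ j xs → count j xs ≤ count (suc j) xs
  count-step j []       = z≤n
  count-step j (x ∷ xs) with Q? j x | Q? (suc j) x
  ... | yes _  | yes _   = s≤s (count-step j xs)
  ... | yes qx | no ¬qx′ = contradiction (Q-step qx) ¬qx′
  ... | no  _  | yes _   = m≤n⇒m≤1+n (count-step j xs)
  ... | no  _  | no  _   = count-step j xs

  count-stuck : ∀ j xs → count (suc j) xs ≡ count j xs → Stuck xs j
  count-stuck j (y ∷ xs) eq x∈ qx′ with Q? j y | Q? (suc j) y | x∈
  ... | yes _  | yes _   | there x∈xs = count-stuck j xs (suc-injective eq) x∈xs qx′
  ... | yes qy | _       | here refl  = qy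
  ... | yes qy | no ¬qy′ | there _    = contradiction (Q-step qy) ¬qy′
  ... | no  _  | yes _   | _          = contradiction (≤-trans (≤-reflexive eq) (count-step j xs)) (n≮n _)
  ... | no  _  | no ¬qy′ | here refl  = contradiction qx′ ¬qy′
  ... | no  _  | no  _   | there x∈xs = count-stuck j xs eq x∈xs qx′

  stuck-or-grown : ∀ xs n → (∃ λ j → j < n × Stuck xs j) ⊎ n ≤ count n xs
  stuck-or-grown xs zero = inj₂ z≤n
  stuck-or-grown xs (suc n) with stuck-or-grown xs n
  ... | inj₁ (j , j<n , stuck) = inj₁ (j , m≤n⇒m≤1+n j<n , stuck)
  ... | inj₂ n≤count with count (suc n) xs ≟ count n xs
  ...   | yes eq  = inj₁ (n , ≤-refl , count-stuck n xs eq)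
  ...   | no  neq = inj₂ (≤-trans (s≤s n≤count) (≤∧≢⇒< (count-step n xs) (neq ∘ sym)))

  -- Pigeonhole: count j xs grows with j and is bounded by length xs.
  stabilises : ∀ k xs → length xs ≤ k → ∃ λ j → j ≤ k × Stuck xs j
  stabilises k xs |xs|≤k with stuck-or-grown xs (suc k)
  ... | inj₁ (j , s≤s j≤k , stuck) = j , j≤k , stuck
  ... | inj₂ k<count =
    contradiction (≤-trans k<count (≤-trans (count≤length (suc k) xs) |xs|≤k)) (n≮n _)

module _ {A : Set} (f : A → Form) (v : TAtom → Set) where

  ⟦⋁-map⟧ : ∀ xs → ⟦⋁⟧ (map f xs) v ⇔ Any (λ x → ⟦ f x ⟧ v) xs
  ⟦⋁-map⟧ xs = mk⇔ (⇒ xs) (⇐ xs)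
    where
      ⇒ : ∀ xs → ⟦⋁⟧ (map f xs) v → Any (λ x → ⟦ f x ⟧ v) xs
      ⇒ (x ∷ xs) (inj₁ fx) = here fx
      ⇒ (x ∷ xs) (inj₂ fxs) = there (⇒ xs fxs)
      ⇐ : ∀ xs → Any (λ x → ⟦ f x ⟧ v) xs → ⟦⋁⟧ (map f xs) v
      ⇐ (x ∷ xs) (here fx) = inj₁ fx
      ⇐ (x ∷ xs) (there fxs) = inj₂ (⇐ xs fxs)

  ⟦⋀-map⟧ : ∀ xs → ⟦⋀⟧ (map f xs) v ⇔ All (λ x → ⟦ f x ⟧ v) xs
  ⟦⋀-map⟧ xs = mk⇔ (⇒ xs) (⇐ xs)
    where
      ⇒ : ∀ xs → ⟦⋀⟧ (map f xs) v → All (λ x → ⟦ f x ⟧ v) xs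
      ⇒ []       _          = []
      ⇒ (x ∷ xs) (fx , fxs) = fx ∷ ⇒ xs fxs
      ⇐ : ∀ xs → All (λ x → ⟦ f x ⟧ v) xs → ⟦⋀⟧ (map f xs) v
      ⇐ []       _          = tt
      ⇐ (x ∷ xs) (fx ∷ fxs) = fx , ⇐ xs fxs

⟦⋀-++⟧ : ∀ Fs Gs v → ⟦⋀⟧ (Fs ++ Gs) v ⇔ (⟦⋀⟧ Fs v × ⟦⋀⟧ Gs v)
⟦⋀-++⟧ Fs Gs v = mk⇔ (⇒ Fs) (⇐ Fs)
  where
    ⇒ : ∀ Fs → ⟦⋀⟧ (Fs ++ Gs) v → ⟦⋀⟧ Fs v × ⟦⋀⟧ Gs v
    ⇒ []       gs         = tt , gs
    ⇒ (F ∷ Fs) (f , fsgs) = Product.map₁ (f ,_) (⇒ Fs fsgs)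
    ⇐ : ∀ Fs → ⟦⋀⟧ Fs v × ⟦⋀⟧ Gs v → ⟦⋀⟧ (Fs ++ Gs) v
    ⇐ []       (_ , gs)        = gs
    ⇐ (F ∷ Fs) ((f , fs) , gs) = f , ⇐ Fs (fs , gs)

All-⇔ : ∀ {A : Set} {Q R : A → Set} xs → (∀ {x} → x ∈ xs → Q x ⇔ R x) → All Q xs ⇔ All R xs
All-⇔ xs Q⇔R = mk⇔
  (λ qs → All.tabulate λ x∈xs → to   (Q⇔R x∈xs) (All.lookup qs x∈xs))
  (λ rs → All.tabulate λ x∈xs → from (Q⇔R x∈xs) (All.lookup rs x∈xs))

ruleAtoms : Rule → List ℕ
ruleAtoms r = head r ∷ (pos r ++ neg r)

ruleAtoms⊆At : ∀ {P r q} → r ∈ P → q ∈ ruleAtoms r → q ∈ At P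
ruleAtoms⊆At r∈P q∈r = ∈-concatMap⁺ ruleAtoms (lose r∈P q∈r)

head∈At : ∀ {P r} → r ∈ P → head r ∈ At P
head∈At r∈P = ruleAtoms⊆At r∈P (here refl)

pos⊆At : ∀ {P r a} → r ∈ P → a ∈ pos r → a ∈ At P
pos⊆At r∈P a∈ = ruleAtoms⊆At r∈P (there (∈-++⁺ˡ a∈))

neg⊆At : ∀ {P r b} → r ∈ P → b ∈ neg r → b ∈ At P
neg⊆At {r = r} r∈P b∈ = ruleAtoms⊆At r∈P (there (∈-++⁺ʳ (pos r) b∈))

module _ (M : List ℕ) where

  ∈-reduct⁺ : ∀ P {r} → r ∈ P → All (_∉ M) (neg r) → drule (head r) (pos r) ∈ reduct M P
  ∈-reduct⁺ (r′ ∷ P) r∈P negs with any? (_∈? M) (neg r′) | r∈P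
  ... | yes blocked | here refl = contradiction blocked (All¬⇒¬Any negs)
  ... | yes _       | there r∈P = ∈-reduct⁺ P r∈P negs
  ... | no  _       | here refl = here refl
  ... | no  _       | there r∈P = there (∈-reduct⁺ P r∈P negs)

  ∈-reduct⁻ : ∀ P {q body} → drule q body ∈ reduct M P →
              ∃ λ r → r ∈ P × head r ≡ q × pos r ≡ body × All (_∉ M) (neg r)
  ∈-reduct⁻ (r ∷ P) d∈ with any? (_∈? M) (neg r) | d∈
  ... | no ¬blocked | here refl = r , here refl , refl , refl , ¬Any⇒All¬ (neg r) ¬blocked
  ... | no  _       | there d∈P = Product.map₂ (Product.map₁ there) (∈-reduct⁻ P d∈P)
  ... | yes _       | d∈P       = Product.map₂ (Product.map₁ there) (∈-reduct⁻ P d∈P)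

-- Stage i is the i-th iterate, from ∅, of the immediate-consequence operator of P^M.
module Stages (P : Program) (M : List ℕ) where

  Applicable : (ℕ → Set) → Rule → Set
  Applicable S r = All S (pos r) × All (_∉ M) (neg r)

  Stage : ℕ → ℕ → Set
  Stage zero    q = ⊥
  Stage (suc i) q = Any (λ r → head r ≡ q × Applicable (Stage i) r) P

  Entering : ℕ → ℕ → Set
  Entering j q = Stage (suc j) q × ¬ Stage j q

  stage? : ∀ i q → Dec (Stage i q)
  stage? zero    q = no λ ()
  stage? (suc i) q = any? (λ r → (head r ≟ q) ×-dec
    (All.all? (stage? i) (pos r) ×-dec All.all? (λ b → ¬? (b ∈? M)) (neg r))) P

  stage-suc-mono : ∀ {i j} → (∀ {x} → Stage i x → Stage j x) →
                   ∀ {q} → Stage (suc i) q → Stage (suc j) q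
  stage-suc-mono i⊆j = Any.map (Product.map₂ (Product.map₁ (All.map i⊆j)))

  stage-mono : ∀ {i j} → i ≤ j → ∀ {q} → Stage i q → Stage j q
  stage-mono {suc i} {suc j} (s≤s i≤j) = stage-suc-mono (stage-mono i≤j)

  stage⇒∈At : ∀ {i q} → Stage i q → q ∈ At P
  stage⇒∈At {suc i} stage with find stage
  ... | r , r∈P , refl , _ = head∈At r∈P

  entered : ∀ {j q} → Stage j q → ∃ λ t → t < j × Entering t q
  entered {suc j} {q} stage with stage? j q
  ... | no  ¬stage = j , ≤-refl , stage , ¬stage
  ... | yes stage′ = Product.map₂ (Product.map₁ m≤n⇒m≤1+n) (entered stage′)

  stage⇔entered : ∀ j q → Stage j q ⇔ (∃ λ t → t < j × Entering t q)
  stage⇔entered j q = mk⇔ entered λ (t , t<j , stage , _) → stage-mono t<j stage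

  leastStage : ℕ → ℕ → ℕ
  leastStage q zero    = zero
  leastStage q (suc n) with stage? n q
  ... | yes _ = leastStage q n
  ... | no  _ = suc n

  leastStage-≤ : ∀ q n → leastStage q n ≤ n
  leastStage-≤ q zero    = z≤n
  leastStage-≤ q (suc n) with stage? n q
  ... | yes _ = m≤n⇒m≤1+n (leastStage-≤ q n)
  ... | no  _ = ≤-refl

  leastStage-stage : ∀ q n → Stage n q → Stage (leastStage q n) q
  leastStage-stage q (suc n) stage with stage? n q
  ... | yes stage′ = leastStage-stage q n stage′
  ... | no  _      = stage

  leastStage-least : ∀ q n {i} → i < leastStage q n → ¬ Stage i q
  leastStage-least q (suc n) i< stage with stage? n q
  ... | yes _      = leastStage-least q n i< stage
  ... | no  ¬stage = ¬stage (stage-mono (m<1+n⇒m≤n i<) stage)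

  stage-closed : ∀ {j} → (∀ {x} → Stage (suc j) x → Stage j x) → ∀ n {x} → Stage n x → Stage j x
  stage-closed closed (suc n) = closed ∘ stage-suc-mono (stage-closed closed n)

  stage⇒leastModel : ∀ i {q} → Stage i q → LeastModel (reduct M P) q
  stage⇒leastModel (suc i) stage with find stage
  ... | r , r∈P , refl , body , negs =
    derive (∈-reduct⁺ M P r∈P negs) (All.map (stage⇒leastModel i) body)

  mutual
    leastModel⇒stage : ∀ {q} → LeastModel (reduct M P) q → ∃ λ n → Stage n q
    leastModel⇒stage (derive d∈ body) with ∈-reduct⁻ M P d∈
    ... | r , r∈P , refl , refl , negs =
      Product.map suc (λ body′ → lose r∈P (refl , body′ , negs)) (leastModel⇒stage* body)

    leastModel⇒stage* : ∀ {qs} → All (LeastModel (reduct M P)) qs → ∃ λ n → All (Stage n) qs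
    leastModel⇒stage* []             = 0 , []
    leastModel⇒stage* (lm ∷ lms) with leastModel⇒stage lm | leastModel⇒stage* lms
    ... | m , stage | n , stages =
      m ⊔ n , stage-mono (m≤m⊔n m n) stage ∷ All.map (stage-mono (m≤n⊔m m n)) stages

  -- Restricted to M, the stages form a chain that stops growing at some j ≤ k.
  stages-stabilise : ∀ k → length M ≤ k → (∀ {x} → Stage (suc k) x → x ∈ M) →
                     ∀ n {x} → Stage n x → Stage k x
  stages-stabilise k |M|≤k bounded n stage with Chain.stabilises Stage stage? (stage-mono (n≤1+n _)) k M |M|≤k
  ... | j , j≤k , stuck = stage-mono j≤k (stage-closed closed n stage)
    where
      closed : ∀ {x} → Stage (suc j) x → Stage j x
      closed stage′ = stuck (bounded (stage-mono (s≤s j≤k) stage′)) stage′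

  stage⇒∈stable : StableModel P M → ∀ {i q} → Stage i q → q ∈ M
  stage⇒∈stable (_ , _ , stable) {i} {q} = proj₂ (stable q) ∘ stage⇒leastModel i

  ∈stable⇒stage : StableModel P M → ∀ k → length M ≤ k → ∀ {q} → q ∈ M → Stage k q
  ∈stable⇒stage st@(_ , _ , stable) k |M|≤k {q} q∈M =
    let n , stage = leastModel⇒stage (proj₁ (stable q) q∈M)
    in  stages-stabilise k |M|≤k (stage⇒∈stable st) n stage

  stage⇒stable : ∀ k → Unique M → length M ≤ k → (∀ q → q ∈ M ⇔ Stage (suc k) q) →
                 StableModel P M
  stage⇒stable k unique |M|≤k M⇔stage =
    unique , All.tabulate (stage⇒∈At ∘ to (M⇔stage _)) , λ q →
      (stage⇒leastModel (suc k) ∘ to (M⇔stage q)) ,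
      λ lm → let n , stage = leastModel⇒stage lm in
        from (M⇔stage q) (stage-mono (n≤1+n k) (stages-stabilise k |M|≤k (from (M⇔stage _)) n stage))

∈-range1⁺ : ∀ {t n} → t < n → suc t ∈ range1 n
∈-range1⁺ t<n = ∈-map⁺ suc (∈-upTo⁺ t<n)

∈-range1⁻ : ∀ {i n} → i ∈ range1 n → ∃ λ t → i ≡ suc t × t < n
∈-range1⁻ i∈ with ∈-map⁻ suc i∈
... | t , t∈ , refl = t , refl , ∈-upTo⁻ t∈

∈-range2⁺ : ∀ {t k} → t < k → 2 + t ∈ range2 k
∈-range2⁺ t<k = ∈-map⁺ (2 +_) (∈-upTo⁺ t<k)

∈-range2⁻ : ∀ {i k} → i ∈ range2 k → ∃ λ t → i ≡ 2 + t × t < k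
∈-range2⁻ i∈ with ∈-map⁻ (2 +_) i∈
... | t , t∈ , refl = t , refl , ∈-upTo⁻ t∈

length-range1 : ∀ n → length (range1 n) ≡ n
length-range1 n = trans (length-map suc (upTo n)) (length-upTo n)

length-range2 : ∀ k → length (range2 k) ≡ k
length-range2 k = trans (length-map (2 +_) (upTo k)) (length-upTo k)

unique-range1 : ∀ n → Unique (range1 n)
unique-range1 n = Unique.map⁺ suc-injective (Unique.upTo⁺ n)

unique-range2 : ∀ k → Unique (range2 k)
unique-range2 k = Unique.map⁺ (suc-injective ∘ suc-injective) (Unique.upTo⁺ k)

baseAtom : TAtom → ℕ
baseAtom (c q)    = q
baseAtom (ci q _) = q
baseAtom (c⁻ q _) = q
baseAtom (d q _)  = q

atomsL⁺ : ∀ {Fs F x} → F ∈ Fs → x ∈ atomsF F → x ∈ atomsL Fs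
atomsL⁺ {F ∷ _}  (here refl) x∈F = ∈-++⁺ˡ x∈F
atomsL⁺ {F ∷ _}  (there F∈) x∈F = ∈-++⁺ʳ (atomsF F) (atomsL⁺ F∈ x∈F)

atomsL⁻ : ∀ Fs {x} → x ∈ atomsL Fs → ∃ λ F → F ∈ Fs × x ∈ atomsF F
atomsL⁻ (F ∷ Fs) x∈ with ∈-++⁻ (atomsF F) x∈
... | inj₁ x∈F  = F , here refl , x∈F
... | inj₂ x∈Fs = Product.map₂ (Product.map₁ there) (atomsL⁻ Fs x∈Fs)

atomsL-vars : ∀ {A : Set} (g : A → TAtom) xs → atomsL (map (λ j → var (g j)) xs) ≡ map g xs
atomsL-vars g []       = refl
atomsL-vars g (x ∷ xs) = cong (g x ∷_) (atomsL-vars g xs)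

∈-atomsL-vars⁻ : ∀ {A : Set} (g : A → TAtom) xs {x} → x ∈ atomsL (map (λ j → var (g j)) xs) →
                 ∃ λ y → y ∈ xs × x ≡ g y
∈-atomsL-vars⁻ g xs x∈ = ∈-map⁻ g (subst (_ ∈_) (atomsL-vars g xs) x∈)

∈-atomsL-vars⁺ : ∀ {A : Set} (g : A → TAtom) {xs y} → y ∈ xs →
                 g y ∈ atomsL (map (λ j → var (g j)) xs)
∈-atomsL-vars⁺ g {xs} y∈ = subst (_ ∈_) (sym (atomsL-vars g xs)) (∈-map⁺ g y∈)

F₃-conjuncts : Rule → ℕ → List Form
F₃-conjuncts r i = map (λ a → var (c⁻ a i)) (pos r) ++ map (λ b → ¬f (var (c b))) (neg r) ++
                   (¬f (var (c⁻ (head r) i)) ∷ [])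

atoms-F₃-conjunct : ∀ r i {G x} → G ∈ F₃-conjuncts r i → x ∈ atomsF G → baseAtom x ∈ ruleAtoms r
atoms-F₃-conjunct r i G∈ x∈G with ∈-++⁻ (map (λ a → var (c⁻ a i)) (pos r)) G∈
... | inj₁ G∈pos with ∈-map⁻ _ G∈pos | x∈G
...   | a , a∈ , refl | here refl = there (∈-++⁺ˡ a∈)
atoms-F₃-conjunct r i G∈ x∈G | inj₂ G∈rest with ∈-++⁻ (map (λ b → ¬f (var (c b))) (neg r)) G∈rest
... | inj₁ G∈neg with ∈-map⁻ _ G∈neg | x∈G
...   | b , b∈ , refl | here refl = there (∈-++⁺ʳ (pos r) b∈)
atoms-F₃-conjunct r i G∈ (here refl) | inj₂ G∈rest | inj₂ (here refl) = here refl

atoms-F₃ : ∀ r i {x} → x ∈ atomsF (F₃ r i) → baseAtom x ∈ ruleAtoms r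
atoms-F₃ (rule h [] n) 1 x∈ with atomsL⁻ (map (λ b → ¬f (var (c b))) n) x∈
... | G , G∈ , x∈G with ∈-map⁻ _ G∈ | x∈G
...   | b , b∈n , refl | here refl = there b∈n
atoms-F₃ (rule h (_ ∷ _) n) 1 ()
atoms-F₃ r zero x∈ =
  let G , G∈ , x∈G = atomsL⁻ (F₃-conjuncts r zero) x∈ in atoms-F₃-conjunct r zero G∈ x∈G
atoms-F₃ r (suc (suc i)) x∈ =
  let G , G∈ , x∈G = atomsL⁻ (F₃-conjuncts r (2 + i)) x∈ in atoms-F₃-conjunct r (2 + i) G∈ x∈G

module Theory (k : ℕ) (P : Program) where

  K : ℕ
  K = k * k + 2 * k

  dFormula : ℕ → ℕ → Form
  dFormula q i = var (c q) ⇔f var (d q i)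

  data InT : Form → Set where
    F₁∈T : ∀ {q t} → q ∈ At P → t < k → InT (F₁ q (2 + t))
    F₂∈T : ∀ {q}   → q ∈ At P → InT (F₂ k q)
    F₄∈T : ∀ {q j} → q ∈ At P → j ≤ k → InT (F₄ P q (suc j))
    d∈T  : ∀ {q t} → q ∈ At P → t < K → InT (dFormula q (suc t))

  private
    F₁s F₂s F₄s ds : List Form
    F₁s = concatMap (λ q → map (F₁ q) (range2 k)) (At P)
    F₂s = map (F₂ k) (At P)
    F₄s = concatMap (λ q → map (F₄ P q) (range1 (suc k))) (At P)
    ds  = concatMap (λ q → map (dFormula q) (range1 K)) (At P)

    ∈-family⁺ : ∀ {A : Set} (f : ℕ → A → Form) {q xs x} → q ∈ At P → x ∈ xs →
                f q x ∈ concatMap (λ q → map (f q) xs) (At P)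
    ∈-family⁺ f q∈ x∈ = ∈-concatMap⁺ _ (lose q∈ (∈-map⁺ (f _) x∈))

    ∈-family⁻ : ∀ {A : Set} (f : ℕ → A → Form) {xs F} →
                F ∈ concatMap (λ q → map (f q) xs) (At P) →
                ∃ λ q → ∃ λ x → q ∈ At P × x ∈ xs × F ≡ f q x
    ∈-family⁻ f F∈ with find (∈-concatMap⁻ _ F∈)
    ... | q , q∈ , F∈q with ∈-map⁻ (f q) F∈q
    ...   | x , x∈ , refl = q , x , q∈ , x∈ , refl

  inT⁺ : ∀ {F} → InT F → F ∈ T k P
  inT⁺ (F₁∈T q∈ t<k) = ∈-++⁺ˡ (∈-++⁺ˡ (∈-family⁺ F₁ q∈ (∈-range2⁺ t<k)))
  inT⁺ (F₂∈T q∈)     = ∈-++⁺ˡ (∈-++⁺ʳ F₁s (∈-++⁺ˡ (∈-map⁺ (F₂ k) q∈)))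
  inT⁺ (F₄∈T q∈ j≤k) =
    ∈-++⁺ˡ (∈-++⁺ʳ F₁s (∈-++⁺ʳ F₂s (∈-family⁺ (F₄ P) q∈ (∈-range1⁺ (s≤s j≤k)))))
  inT⁺ (d∈T q∈ t<K)  = ∈-++⁺ʳ (T₀ k P) (∈-family⁺ dFormula q∈ (∈-range1⁺ t<K))

  inT⁻ : ∀ {F} → F ∈ T k P → InT F
  inT⁻ F∈ with ∈-++⁻ (T₀ k P) F∈
  ... | inj₂ F∈ds with ∈-family⁻ dFormula F∈ds
  ...   | q , i , q∈ , i∈ , refl with ∈-range1⁻ i∈
  ...     | t , refl , t<K = d∈T q∈ t<K
  inT⁻ F∈ | inj₁ F∈T₀ with ∈-++⁻ F₁s F∈T₀
  ... | inj₁ F∈F₁s with ∈-family⁻ F₁ F∈F₁s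
  ...   | q , i , q∈ , i∈ , refl with ∈-range2⁻ i∈
  ...     | t , refl , t<k = F₁∈T q∈ t<k
  inT⁻ F∈ | inj₁ F∈T₀ | inj₂ F∈rest with ∈-++⁻ F₂s F∈rest
  ... | inj₁ F∈F₂s with ∈-map⁻ (F₂ k) F∈F₂s
  ...   | q , q∈ , refl = F₂∈T q∈
  inT⁻ F∈ | inj₁ F∈T₀ | inj₂ F∈rest | inj₂ F∈F₄s with ∈-family⁻ (F₄ P) F∈F₄s
  ... | q , i , q∈ , i∈ , refl with ∈-range1⁻ i∈
  ...   | j , refl , s≤s j≤k = F₄∈T q∈ j≤k

  atomsT⇒At : ∀ {x} → x ∈ AtT k P → baseAtom x ∈ At P
  atomsT⇒At x∈ with atomsL⁻ (T k P) x∈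
  ... | F , F∈ , x∈F = atoms (inT⁻ F∈) x∈F
    where
      atoms-ci : ∀ {q x} xs → q ∈ At P → x ∈ atomsL (map (λ j → var (ci q j)) xs) → baseAtom x ∈ At P
      atoms-ci {q} xs q∈ x∈ with ∈-atomsL-vars⁻ (ci q) xs x∈
      ... | _ , _ , refl = q∈

      atoms : ∀ {F x} → InT F → x ∈ atomsF F → baseAtom x ∈ At P
      atoms (F₁∈T q∈ _) (here refl)        = q∈
      atoms (F₁∈T {t = t} q∈ _) (there x∈) = atoms-ci (range1 (suc t)) q∈ x∈
      atoms (F₂∈T q∈)   (here refl)        = q∈
      atoms (F₂∈T q∈)   (there x∈)         = atoms-ci (range1 (suc k)) q∈ x∈
      atoms (F₄∈T q∈ _) (here refl)        = q∈
      atoms (F₄∈T {q} {j} q∈ _) (there x∈)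
        with atomsL⁻ (map (λ r → F₃ r (suc j)) (rulesWithHead P q)) x∈
      ... | G , G∈ , x∈G with ∈-map⁻ _ G∈
      ...   | r , r∈ , refl =
        ruleAtoms⊆At (proj₁ (∈-filter⁻ (λ r → head r ≟ q) {xs = P} r∈)) (atoms-F₃ r (suc j) x∈G)
      atoms (d∈T q∈ _)  (here refl)        = q∈
      atoms (d∈T q∈ _)  (there (here refl)) = q∈

¬-⇔ : ∀ {A B : Set} → A ⇔ B → (¬ A) ⇔ (¬ B)
¬-⇔ A⇔B = mk⇔ (λ ¬a → ¬a ∘ from A⇔B) (λ ¬b → ¬b ∘ to A⇔B)

module Semantics (P : Program) (M : List ℕ) (v : TAtom → Set)
                 (c-correct : ∀ {b} → b ∈ At P → v (c b) ⇔ b ∈ M) where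
  open Stages P M

  C⁻Correct : ℕ → Set
  C⁻Correct j = ∀ {a} → a ∈ At P → v (c⁻ a (suc j)) ⇔ Stage j a

  ⟦¬c⟧ : ∀ {r} → r ∈ P → ⟦⋀⟧ (map (λ b → ¬f (var (c b))) (neg r)) v ⇔ All (_∉ M) (neg r)
  ⟦¬c⟧ {r} r∈P =
    ⇔.trans (⟦⋀-map⟧ _ v (neg r)) (All-⇔ (neg r) (¬-⇔ ∘ c-correct ∘ neg⊆At r∈P))

  -- F₃(r,1) mentions no c⁻ atom, hence the hypothesis is only needed for j > 0.
  ⟦F₃⟧ : ∀ j → (0 < j → C⁻Correct j) → ∀ {r} → r ∈ P →
         ⟦ F₃ r (suc j) ⟧ v ⇔ (Applicable (Stage j) r × ¬ Stage j (head r))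
  ⟦F₃⟧ zero _ {rule h [] n} r∈P =
    mk⇔ (λ ns → ([] , to (⟦¬c⟧ r∈P) ns) , λ ()) (λ ((_ , ns) , _) → from (⟦¬c⟧ r∈P) ns)
  ⟦F₃⟧ zero _ {rule h (_ ∷ _) n} r∈P = mk⇔ (λ ()) λ { ((() ∷ _ , _) , _) }
  ⟦F₃⟧ (suc j) c⁻-correct {r} r∈P = mk⇔ ⇒ ⇐
    where
      posLits negLits : List Form
      posLits = map (λ a → var (c⁻ a (2 + j))) (pos r)
      negLits = map (λ b → ¬f (var (c b))) (neg r)
      pos⇔ : ⟦⋀⟧ posLits v ⇔ All (Stage (suc j)) (pos r)
      pos⇔ = ⇔.trans (⟦⋀-map⟧ _ v (pos r)) (All-⇔ (pos r) (c⁻-correct z<s ∘ pos⊆At r∈P))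
      head⇔ : v (c⁻ (head r) (2 + j)) ⇔ Stage (suc j) (head r)
      head⇔ = c⁻-correct z<s (head∈At r∈P)
      ⇒ : ⟦ F₃ r (2 + j) ⟧ v → Applicable (Stage (suc j)) r × ¬ Stage (suc j) (head r)
      ⇒ sat with to (⟦⋀-++⟧ posLits _ v) sat
      ... | ps , rest with to (⟦⋀-++⟧ negLits _ v) rest
      ...   | ns , ¬h , _ = (to pos⇔ ps , to (⟦¬c⟧ r∈P) ns) , ¬h ∘ from head⇔
      ⇐ : Applicable (Stage (suc j)) r × ¬ Stage (suc j) (head r) → ⟦ F₃ r (2 + j) ⟧ v
      ⇐ ((ps , ns) , ¬h) =
        from (⟦⋀-++⟧ posLits _ v)
          (from pos⇔ ps , from (⟦⋀-++⟧ negLits _ v) (from (⟦¬c⟧ r∈P) ns , ¬h ∘ to head⇔ , tt))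

  ⟦⋁F₃⟧ : ∀ j q → (0 < j → C⁻Correct j) →
          ⟦ ⋁ (map (λ r → F₃ r (suc j)) (rulesWithHead P q)) ⟧ v ⇔ Entering j q
  ⟦⋁F₃⟧ j q c⁻-correct = mk⇔ ⇒ ⇐
    where
      ⋁⇔ = ⟦⋁-map⟧ (λ r → F₃ r (suc j)) v (rulesWithHead P q)
      ⇒ : ⟦ ⋁ (map (λ r → F₃ r (suc j)) (rulesWithHead P q)) ⟧ v → Entering j q
      ⇒ sat with find (to ⋁⇔ sat)
      ... | r , r∈ , F₃-sat with ∈-filter⁻ (λ r → head r ≟ q) {xs = P} r∈
      ...   | r∈P , refl with to (⟦F₃⟧ j c⁻-correct r∈P) F₃-sat
      ...     | applicable , ¬stage = lose r∈P (refl , applicable) , ¬stage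
      ⇐ : Entering j q → ⟦ ⋁ (map (λ r → F₃ r (suc j)) (rulesWithHead P q)) ⟧ v
      ⇐ (stage , ¬stage) with find stage
      ... | r , r∈P , refl , applicable =
        from ⋁⇔ (lose (∈-filter⁺ (λ r → head r ≟ q) r∈P refl)
                      (from (⟦F₃⟧ j c⁻-correct r∈P) (applicable , ¬stage)))

  ⟦⋁ci⟧ : ∀ j q → (∀ {t} → t < j → v (ci q (suc t)) ⇔ Entering t q) →
          ⟦⋁⟧ (map (λ i → var (ci q i)) (range1 j)) v ⇔ Stage j q
  ⟦⋁ci⟧ j q ci-correct =
    ⇔.trans (⟦⋁-map⟧ _ v (range1 j)) (⇔.trans (mk⇔ ⇒ ⇐) (⇔.sym (stage⇔entered j q)))
    where
      ⇒ : Any (λ i → v (ci q i)) (range1 j) → ∃ λ t → t < j × Entering t q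
      ⇒ sat with find sat
      ... | i , i∈ , ci-sat with ∈-range1⁻ i∈
      ...   | t , refl , t<j = t , t<j , to (ci-correct t<j) ci-sat
      ⇐ : (∃ λ t → t < j × Entering t q) → Any (λ i → v (ci q i)) (range1 j)
      ⇐ (t , t<j , entering) = lose (∈-range1⁺ t<j) (from (ci-correct t<j) entering)

⇔⇒× : ∀ {A B : Set} → A ⇔ B → (A → B) × (B → A)
⇔⇒× A⇔B = to A⇔B , from A⇔B

cAtoms : List TAtom → List ℕ
cAtoms []            = []
cAtoms (c q    ∷ xs) = q ∷ cAtoms xs
cAtoms (ci _ _ ∷ xs) = cAtoms xs
cAtoms (c⁻ _ _ ∷ xs) = cAtoms xs
cAtoms (d _ _  ∷ xs) = cAtoms xs

∈-cAtoms⁺ : ∀ {q} xs → c q ∈ xs → q ∈ cAtoms xs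
∈-cAtoms⁺ (c _    ∷ _)  (here refl) = here refl
∈-cAtoms⁺ (c _    ∷ xs) (there c∈)  = there (∈-cAtoms⁺ xs c∈)
∈-cAtoms⁺ (ci _ _ ∷ xs) (there c∈)  = ∈-cAtoms⁺ xs c∈
∈-cAtoms⁺ (c⁻ _ _ ∷ xs) (there c∈)  = ∈-cAtoms⁺ xs c∈
∈-cAtoms⁺ (d _ _  ∷ xs) (there c∈)  = ∈-cAtoms⁺ xs c∈

∈-cAtoms⁻ : ∀ {q} xs → q ∈ cAtoms xs → c q ∈ xs
∈-cAtoms⁻ (c _    ∷ _)  (here refl) = here refl
∈-cAtoms⁻ (c _    ∷ xs) (there q∈)  = there (∈-cAtoms⁻ xs q∈)
∈-cAtoms⁻ (ci _ _ ∷ xs) q∈          = there (∈-cAtoms⁻ xs q∈)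
∈-cAtoms⁻ (c⁻ _ _ ∷ xs) q∈          = there (∈-cAtoms⁻ xs q∈)
∈-cAtoms⁻ (d _ _  ∷ xs) q∈          = there (∈-cAtoms⁻ xs q∈)

unique-cAtoms : ∀ xs → Unique xs → Unique (cAtoms xs)
unique-cAtoms []            []          = []
unique-cAtoms (c q    ∷ xs) (c∉ ∷ u) =
  All.tabulate (λ q′∈ q≡q′ → All.lookup c∉ (∈-cAtoms⁻ xs q′∈) (cong c q≡q′)) ∷ unique-cAtoms xs u
unique-cAtoms (ci _ _ ∷ xs) (_  ∷ u) = unique-cAtoms xs u
unique-cAtoms (c⁻ _ _ ∷ xs) (_  ∷ u) = unique-cAtoms xs u
unique-cAtoms (d _ _  ∷ xs) (_  ∷ u) = unique-cAtoms xs u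

module FromModel (k : ℕ) (P : Program) (N : List TAtom) (model : ModelT k P N) where
  open Theory k P

  M : List ℕ
  M = cAtoms N

  v : TAtom → Set
  v x = x ∈ N

  unique-N : Unique N
  unique-N = proj₁ model

  sat⇔ : ∀ {F G} → InT (F ⇔f G) → ⟦ F ⟧ v ⇔ ⟦ G ⟧ v
  sat⇔ F∈T = Product.uncurry mk⇔ (All.lookup (proj₂ (proj₂ model)) (inT⁺ F∈T))

  c∈N⇒∈At : ∀ {q} → c q ∈ N → q ∈ At P
  c∈N⇒∈At c∈N = atomsT⇒At (All.lookup (proj₁ (proj₂ model)) c∈N)

  open Stages P M
  open Semantics P M v (λ _ → mk⇔ (∈-cAtoms⁺ N) (∈-cAtoms⁻ N))

  -- Each q ∈ M contributes the K + 1 distinct atoms c(q), d(q,1), …, d(q,K) to N.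
  |M|≤k : length N ≤ (k + 1) * K → length M ≤ k
  |M|≤k |N|≤ = m<1+n⇒m≤n (*-cancelʳ-< (suc K) (length M) (suc k) (begin-strict
      length M * suc K                ≡⟨ length-concatMap-const dBlock (suc K) M |dBlock| ⟨
      length (concatMap dBlock M)     ≤⟨ unique-⊆⇒length-≤ unique-dBlocks dBlocks⊆N ⟩
      length N                        ≤⟨ |N|≤ ⟩
      (k + 1) * K                     ≡⟨ cong (_* K) (+-comm k 1) ⟩
      suc k * K                       <⟨ *-monoʳ-< (suc k) (n<1+n K) ⟩
      suc k * suc K                   ∎))
    where
      open ≤-Reasoning
      dBlock : ℕ → List TAtom
      dBlock q = c q ∷ map (d q) (range1 K)
      |dBlock| : ∀ q → length (dBlock q) ≡ suc K
      |dBlock| q = cong suc (trans (length-map (d q) (range1 K)) (length-range1 K))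
      owner : ∀ {q x} → x ∈ dBlock q → baseAtom x ≡ q
      owner (here refl) = refl
      owner (there x∈) with ∈-map⁻ _ x∈
      ... | _ , _ , refl = refl
      unique-dBlocks : Unique (concatMap dBlock M)
      unique-dBlocks = unique-concatMap dBlock baseAtom owner (unique-cAtoms N unique-N) λ q →
        ¬Any⇒All¬ _ (∉-map (range1 K) λ _ ()) ∷ Unique.map⁺ (λ { refl → refl }) (unique-range1 K)
      dBlocks⊆N : ∀ {x} → x ∈ concatMap dBlock M → x ∈ N
      dBlocks⊆N x∈ with find (∈-concatMap⁻ dBlock {xs = M} x∈)
      ... | q , q∈M , here refl = ∈-cAtoms⁻ N q∈M
      ... | q , q∈M , there x∈d with ∈-map⁻ (d q) x∈d
      ...   | i , i∈ , refl with ∈-range1⁻ i∈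
      ...     | t , refl , t<K = to (sat⇔ (d∈T (c∈N⇒∈At c∈N) t<K)) c∈N
        where c∈N = ∈-cAtoms⁻ N q∈M

  CiCorrect : ℕ → Set
  CiCorrect t = ∀ {q} → q ∈ At P → v (ci q (suc t)) ⇔ Entering t q

  c⁻-correct : ∀ {j} → j ≤ k → (∀ {t} → t < j → CiCorrect t) → 0 < j → C⁻Correct j
  c⁻-correct {suc j} j<k below _ {a} a∈ =
    ⇔.trans (sat⇔ (F₁∈T a∈ j<k)) (⟦⋁ci⟧ (suc j) a λ t<j → below t<j a∈)

  ci-correct-step : ∀ {j} → j ≤ k → (∀ {t} → t < j → CiCorrect t) → CiCorrect j
  ci-correct-step {j} j≤k below {q} q∈ =
    ⇔.trans (sat⇔ (F₄∈T q∈ j≤k)) (⟦⋁F₃⟧ j q (c⁻-correct j≤k below))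

  ci-correct : ∀ t → t ≤ k → CiCorrect t
  ci-correct = <-rec (λ t → t ≤ k → CiCorrect t) λ j below j≤k →
    ci-correct-step j≤k λ t<j → below t<j (≤-trans (<⇒≤ t<j) j≤k)

  c∈N⇔stage : ∀ {q} → q ∈ At P → c q ∈ N ⇔ Stage (suc k) q
  c∈N⇔stage {q} q∈ =
    ⇔.trans (sat⇔ (F₂∈T q∈)) (⟦⋁ci⟧ (suc k) q λ t≤k → ci-correct _ (m<1+n⇒m≤n t≤k) q∈)

  M⇔stage : ∀ q → q ∈ M ⇔ Stage (suc k) q
  M⇔stage q = mk⇔
    (λ q∈M → let c∈N = ∈-cAtoms⁻ N q∈M in to (c∈N⇔stage (c∈N⇒∈At c∈N)) c∈N)
    (λ stage → ∈-cAtoms⁺ N (from (c∈N⇔stage (stage⇒∈At stage)) stage))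

  stableModel : length N ≤ (k + 1) * K → StableModel P M × length M ≤ k
  stableModel |N|≤ = stage⇒stable k (unique-cAtoms N unique-N) (|M|≤k |N|≤) M⇔stage , |M|≤k |N|≤

-- From a stable model M with |M| ≤ k: put c(q) and d(q,·) in for q ∈ M, c(q,i) exactly at the
-- stage i at which q is derived, and c⁻(q,i) for every later i ≤ k + 1.
module ToModel (k : ℕ) (P : Program) (M : List ℕ) (stable : StableModel P M) (|M|≤k : length M ≤ k) where
  open Theory k P
  open Stages P M

  level : ℕ → ℕ
  level q = leastStage q k

  stage⇔level : ∀ {i q} → Stage i q ⇔ (q ∈ M × level q ≤ i)
  stage⇔level {i} {q} = mk⇔
    (λ stage → stage⇒∈stable stable stage , ≮⇒≥ λ i<level → leastStage-least q k i<level stage)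
    (λ (q∈M , level≤i) →
       stage-mono level≤i (leastStage-stage q k (∈stable⇒stage stable k |M|≤k q∈M)))

  entering⇔level : ∀ {j q} → Entering j q ⇔ (q ∈ M × suc j ≡ level q)
  entering⇔level {j} {q} = mk⇔
    (λ (stage , ¬stage) → let q∈M , level≤ = to stage⇔level stage in
       q∈M , ≤-antisym (≰⇒> λ level≤j → ¬stage (from stage⇔level (q∈M , level≤j))) level≤)
    (λ (q∈M , j+1≡level) → from stage⇔level (q∈M , ≤-reflexive (sym j+1≡level)) ,
       λ stage → n≮n j (≤-trans (≤-reflexive j+1≡level) (proj₂ (to stage⇔level stage))))

  level∈range1 : ∀ {q} → q ∈ M → level q ∈ range1 (suc k)
  level∈range1 {q} q∈M with level q in eq
  ... | zero  = ⊥-elim (subst (λ i → Stage i q) eq (from stage⇔level (q∈M , ≤-refl)))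
  ... | suc t = ∈-range1⁺ (m≤n⇒m≤1+n (subst (_≤ k) eq (leastStage-≤ q k)))

  later : ℕ → List ℕ
  later q = filter (level q <?_) (range2 k)

  block : ℕ → List TAtom
  block q = c q ∷ ci q (level q) ∷ map (d q) (range1 K) ++ map (c⁻ q) (later q)

  data InBlock (q : ℕ) : TAtom → Set where
    c∈  : InBlock q (c q)
    ci∈ : ∀ {i} → i ≡ level q → InBlock q (ci q i)
    d∈  : ∀ {t} → t < K → InBlock q (d q (suc t))
    c⁻∈ : ∀ {t} → t < k → level q < 2 + t → InBlock q (c⁻ q (2 + t))

  inBlock⁺ : ∀ {q x} → InBlock q x → x ∈ block q
  inBlock⁺     c∈              = here refl
  inBlock⁺     (ci∈ refl)      = there (here refl)
  inBlock⁺ {q} (d∈ t<K)        = there (there (∈-++⁺ˡ (∈-map⁺ (d q) (∈-range1⁺ t<K))))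
  inBlock⁺ {q} (c⁻∈ t<k level<) =
    there (there (∈-++⁺ʳ _ (∈-map⁺ (c⁻ q) (∈-filter⁺ (level q <?_) (∈-range2⁺ t<k) level<))))

  inBlock⁻ : ∀ {q x} → x ∈ block q → InBlock q x
  inBlock⁻     (here refl)         = c∈
  inBlock⁻     (there (here refl)) = ci∈ refl
  inBlock⁻ {q} (there (there x∈)) with ∈-++⁻ (map (d q) (range1 K)) x∈
  ... | inj₁ x∈ds with ∈-map⁻ (d q) x∈ds
  ...   | i , i∈ , refl with ∈-range1⁻ i∈
  ...     | t , refl , t<K = d∈ t<K
  inBlock⁻ {q} (there (there x∈)) | inj₂ x∈cs with ∈-map⁻ (c⁻ q) x∈cs
  ... | i , i∈ , refl with ∈-filter⁻ (level q <?_) {xs = range2 k} i∈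
  ...   | i∈range2 , level< with ∈-range2⁻ i∈range2
  ...     | t , refl , t<k = c⁻∈ t<k level<

  baseAtom-inBlock : ∀ {q x} → InBlock q x → baseAtom x ≡ q
  baseAtom-inBlock c∈        = refl
  baseAtom-inBlock (ci∈ _)   = refl
  baseAtom-inBlock (d∈ _)    = refl
  baseAtom-inBlock (c⁻∈ _ _) = refl

  unique-block : ∀ q → Unique (block q)
  unique-block q =
    ¬Any⇒All¬ _ (λ { (here ()) ; (there x∈) → ∉-rest (λ ()) (λ ()) x∈ }) ∷
    ¬Any⇒All¬ _ (∉-rest (λ ()) (λ ())) ∷
    Unique.++⁺ (Unique.map⁺ (λ { refl → refl }) (unique-range1 K))
               (Unique.map⁺ (λ { refl → refl }) (Unique.filter⁺ (level q <?_) (unique-range2 k)))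
               (disjoint-map (range1 K) (later q) λ _ _ ())
    where
      ∉-rest : ∀ {x} → (∀ {t} → d q t ≢ x) → (∀ {t} → c⁻ q t ≢ x) →
               x ∉ map (d q) (range1 K) ++ map (c⁻ q) (later q)
      ∉-rest d≢x c⁻≢x x∈ with ∈-++⁻ (map (d q) (range1 K)) x∈
      ... | inj₁ x∈ds = ∉-map (range1 K) (λ _ → d≢x) x∈ds
      ... | inj₂ x∈cs = ∉-map (later q) (λ _ → c⁻≢x) x∈cs

  length-block : ∀ q → length (block q) ≤ 2 + (K + k)
  length-block q = s≤s (s≤s (begin
    length (map (d q) (range1 K) ++ map (c⁻ q) (later q))   ≡⟨ length-++ (map (d q) (range1 K)) ⟩
    length (map (d q) (range1 K)) + length (map (c⁻ q) (later q))
      ≡⟨ cong₂ _+_ (trans (length-map (d q) (range1 K)) (length-range1 K)) (length-map (c⁻ q) (later q)) ⟩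
    K + length (later q)                                    ≤⟨ +-monoʳ-≤ K (length-filter (level q <?_) (range2 k)) ⟩
    K + length (range2 k)                                   ≡⟨ cong (K +_) (length-range2 k) ⟩
    K + k                                                   ∎))
    where open ≤-Reasoning

  N : List TAtom
  N = concatMap block M

  v : TAtom → Set
  v x = x ∈ N

  ∈N⁺ : ∀ {q x} → q ∈ M → InBlock q x → x ∈ N
  ∈N⁺ q∈M x∈ = ∈-concatMap⁺ block (lose q∈M (inBlock⁺ x∈))

  ∈N⁻ : ∀ {x} → x ∈ N → ∃ λ q → q ∈ M × InBlock q x
  ∈N⁻ x∈ with find (∈-concatMap⁻ block {xs = M} x∈)
  ... | q , q∈M , x∈block = q , q∈M , inBlock⁻ x∈block

  c∈N⇔∈M : ∀ {q} → c q ∈ N ⇔ q ∈ M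
  c∈N⇔∈M {q} = mk⇔ ⇒ (λ q∈M → ∈N⁺ q∈M c∈)
    where
      ⇒ : c q ∈ N → q ∈ M
      ⇒ c∈N with ∈N⁻ c∈N
      ... | _ , q∈M , c∈ = q∈M

  d∈N⇔∈M : ∀ {q t} → t < K → d q (suc t) ∈ N ⇔ q ∈ M
  d∈N⇔∈M {q} {t} t<K = mk⇔ ⇒ (λ q∈M → ∈N⁺ q∈M (d∈ t<K))
    where
      ⇒ : d q (suc t) ∈ N → q ∈ M
      ⇒ d∈N with ∈N⁻ d∈N
      ... | _ , q∈M , d∈ _ = q∈M

  ci∈N⇔entering : ∀ {q t} → ci q (suc t) ∈ N ⇔ Entering t q
  ci∈N⇔entering {q} {t} = mk⇔ ⇒ λ entering →
    let q∈M , eq = to entering⇔level entering in ∈N⁺ q∈M (ci∈ eq)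
    where
      ⇒ : ci q (suc t) ∈ N → Entering t q
      ⇒ ci∈N with ∈N⁻ ci∈N
      ... | _ , q∈M , ci∈ eq = from entering⇔level (q∈M , eq)

  c⁻∈N⇔stage : ∀ {a t} → t < k → c⁻ a (2 + t) ∈ N ⇔ Stage (suc t) a
  c⁻∈N⇔stage {a} {t} t<k = mk⇔ ⇒ λ stage →
    let a∈M , level≤ = to stage⇔level stage in ∈N⁺ a∈M (c⁻∈ t<k (s≤s level≤))
    where
      ⇒ : c⁻ a (2 + t) ∈ N → Stage (suc t) a
      ⇒ c⁻∈N with ∈N⁻ c⁻∈N
      ... | _ , a∈M , c⁻∈ _ level< = from stage⇔level (a∈M , ≤-pred level<)

  M⇔stage : ∀ {q} → q ∈ M ⇔ Stage (suc k) q
  M⇔stage = mk⇔ (stage-mono (n≤1+n k) ∘ ∈stable⇒stage stable k |M|≤k) (stage⇒∈stable stable)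

  open Semantics P M v (λ _ → c∈N⇔∈M)

  c⁻-correct : ∀ {j} → j ≤ k → 0 < j → C⁻Correct j
  c⁻-correct {suc t} t<k _ _ = c⁻∈N⇔stage t<k

  satisfies : ∀ {F} → InT F → ⟦ F ⟧ v
  satisfies (F₁∈T {q} {t} _ t<k) =
    ⇔⇒× (⇔.trans (c⁻∈N⇔stage t<k) (⇔.sym (⟦⋁ci⟧ (suc t) q λ _ → ci∈N⇔entering)))
  satisfies (F₂∈T {q} _) =
    ⇔⇒× (⇔.trans c∈N⇔∈M (⇔.trans M⇔stage (⇔.sym (⟦⋁ci⟧ (suc k) q λ _ → ci∈N⇔entering))))
  satisfies (F₄∈T {q} {j} _ j≤k) =
    ⇔⇒× (⇔.trans ci∈N⇔entering (⇔.sym (⟦⋁F₃⟧ j q (c⁻-correct j≤k))))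
  satisfies (d∈T _ t<K) = ⇔⇒× (⇔.trans c∈N⇔∈M (⇔.sym (d∈N⇔∈M t<K)))

  M⊆At : ∀ {q} → q ∈ M → q ∈ At P
  M⊆At = All.lookup (proj₁ (proj₂ stable))

  atoms-N : ∀ {x} → x ∈ N → x ∈ AtT k P
  atoms-N x∈ with ∈N⁻ x∈
  ... | q , q∈M , c∈        = atomsL⁺ (inT⁺ (F₂∈T (M⊆At q∈M))) (here refl)
  ... | q , q∈M , ci∈ refl  =
    atomsL⁺ (inT⁺ (F₂∈T (M⊆At q∈M))) (there (∈-atomsL-vars⁺ (ci q) (level∈range1 q∈M)))
  ... | q , q∈M , d∈ t<K    = atomsL⁺ (inT⁺ (d∈T (M⊆At q∈M) t<K)) (there (here refl))
  ... | q , q∈M , c⁻∈ t<k _ = atomsL⁺ (inT⁺ (F₁∈T (M⊆At q∈M) t<k)) (here refl)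

  length-N : length N ≤ (k + 1) * K
  length-N = begin
    length N                 ≤⟨ length-concatMap-≤ block _ M length-block ⟩
    length M * (2 + (K + k)) ≤⟨ *-monoˡ-≤ _ |M|≤k ⟩
    k * (2 + (K + k))        ≡⟨ size k ⟩
    (k + 1) * K              ∎
    where
      open ≤-Reasoning
      size : ∀ k → k * (2 + ((k * k + 2 * k) + k)) ≡ (k + 1) * (k * k + 2 * k)
      size = solve-∀

  model : ModelT k P N × length N ≤ (k + 1) * K
  model = ( unique-concatMap block baseAtom (baseAtom-inBlock ∘ inBlock⁻) (proj₁ stable) unique-block
          , All.tabulate atoms-N
          , All.tabulate (satisfies ∘ inT⁻) )
        , length-N

mainTheorem10 : (k : ℕ) (P : Program) →
    (∃ λ M → StableModel P M × length M ≤ k) ⇔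
    (∃ λ N → ModelT k P N × length N ≤ (k + 1) * (k * k + 2 * k))
mainTheorem10 k P = mk⇔
  (λ (M , stable , |M|≤k) → ToModel.N k P M stable |M|≤k , ToModel.model k P M stable |M|≤k)
  (λ (N , model , |N|≤) → FromModel.M k P N model , FromModel.stableModel k P N model |N|≤)
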